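{- Let $p\colon\mathbb{E}\to\mathbb{B}$ be a CLat$_\wedge$-fibration, $G\colon\mathbb{B}\to\mathbb{B}$ a functor, $\delta\colon S\to GS$ a $G$-coalgebra in $\mathbb{B}$, and $\dot G\colon\mathbb{E}\to\mathbb{E}$ a lifting of $G$ along $p$ such that each restriction $\dot G_X\colon\mathbb{E}_X\to\mathbb{E}_{GX}$ is $\omega^{\mathrm{op}}$-continuous. Let $\iota,\alpha\in\mathbb{E}_S$. Assume further that each $\dot G_X$ preserves all meets, and let $\dot H_S\colon\mathbb{E}_{GS}\to\mathbb{E}_S$ be the left adjoint of $\dot G_S$. Then $$\iota\le\nu x.\,(\alpha\wedge\delta^*\dot G_S x)\quad\text{if and only if}\quad \mu x.\,(\iota\vee\dot H_S\delta_* x)\le\alpha,$$ where the fixed points are taken in the complete lattice $\mathbb{E}_S$.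
   Context: A fibration $p\colon\mathbb{E}\to\mathbb{B}$ is a functor such that for each $Q\in\mathbb{E}$ and $l\colon X\to pQ$ in $\mathbb{B}$ there is a cartesian lifting $l^*Q\to Q$; the fibre $\mathbb{E}_X$ consists of objects over $X$ and morphisms over $\mathrm{id}_X$, and $l\colon X\to Y$ induces the reindexing (pullback) functor $l^*\colon\mathbb{E}_Y\to\mathbb{E}_X$. A CLat$_\wedge$-fibration is a fibration in which every fibre $\mathbb{E}_X$ is a complete lattice (a poset) and every reindexing $l^*$ preserves all meets; then $l^*$ has a left adjoint, denoted $l_*\colon\mathbb{E}_X\to\mathbb{E}_Y$. A lifting of $G$ along $p$ is a functor $\dot G\colon\mathbb{E}\to\mathbb{E}$ with $p\circ\dot G=G\circ p$; $\dot G_X\colon\mathbb{E}_X\to\mathbb{E}_{GX}$ denotes its restriction to fibres. $\omega^{\mathrm{op}}$-continuous means preserving infima of decreasing $\omega$-chains. $\nu$ and $\mu$ denote greatest and least fixed points. -}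

module Defs where

open import Level using (Level; _⊔_; Lift) renaming (suc to lsuc)
open import Data.Product using (Σ; _×_; _,_; proj₁; proj₂)
open import Data.Sum using (_⊎_)
open import Data.Nat using (ℕ; suc)
open import Relation.Binary.PropositionalEquality using (_≡_; subst; subst₂; sym; trans; cong)

record Category (o h : Level) : Set (lsuc (o ⊔ h)) where
  infixr 9 _∘_
  field
    Obj : Set o
    Hom : Obj → Obj → Set h
    id  : ∀ {A} → Hom A A
    _∘_ : ∀ {A B C} → Hom B C → Hom A B → Hom A C
    identityˡ : ∀ {A B} (f : Hom A B) → id ∘ f ≡ f
    identityʳ : ∀ {A B} (f : Hom A B) → f ∘ id ≡ f
    assoc : ∀ {A B C D} (f : Hom C D) (g : Hom B C) (k : Hom A B) →
            (f ∘ g) ∘ k ≡ f ∘ (g ∘ k)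

record Functor {o h : Level} (C D : Category o h) : Set (o ⊔ h) where
  private
    module C = Category C
    module D = Category D
  field
    F₀ : C.Obj → D.Obj
    F₁ : ∀ {A B} → C.Hom A B → D.Hom (F₀ A) (F₀ B)
    identity : ∀ {A} → F₁ (C.id {A}) ≡ D.id
    homomorphism : ∀ {A B C'} (f : C.Hom B C') (g : C.Hom A B) →
                   F₁ (f C.∘ g) ≡ F₁ f D.∘ F₁ g

module _ {a r : Level} {C : Set a} (_≤_ : C → C → Set r) where

  IsMeet : ∀ {κ} → (C → Set κ) → C → Set (a ⊔ r ⊔ κ)
  IsMeet S m = (∀ x → S x → m ≤ x) × (∀ z → (∀ x → S x → z ≤ x) → z ≤ m)

  IsGFP : (C → C) → C → Set (a ⊔ r)
  IsGFP f n = (f n ≡ n) × (∀ y → f y ≡ y → y ≤ n)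

  IsLFP : (C → C) → C → Set (a ⊔ r)
  IsLFP f m = (f m ≡ m) × (∀ y → f y ≡ y → m ≤ y)

module _ {a r b s : Level} {C : Set a} {D : Set b}
         (_≤C_ : C → C → Set r) (_≤D_ : D → D → Set s) where

  PreservesMeets : (κ : Level) → (C → D) → Set (a ⊔ r ⊔ b ⊔ s ⊔ lsuc κ)
  PreservesMeets κ f = ∀ (S : C → Set κ) m → IsMeet _≤C_ S m →
    IsMeet _≤D_ (λ y → Σ C λ x → S x × (f x ≡ y)) (f m)

  OmegaOpContinuous : (C → D) → Set (a ⊔ r ⊔ b ⊔ s)
  OmegaOpContinuous f = ∀ (c : ℕ → C) → (∀ n → c (suc n) ≤C c n) → ∀ m →
    IsMeet _≤C_ (λ y → Σ ℕ λ n → c n ≡ y) m →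
    IsMeet _≤D_ (λ y → Σ ℕ λ n → f (c n) ≡ y) (f m)

  IsLeftAdjointOf : (D → C) → (C → D) → Set (a ⊔ r ⊔ b ⊔ s)
  IsLeftAdjointOf g f = ∀ x y → ((g x ≤C y) → (x ≤D f y)) × ((x ≤D f y) → (g x ≤C y))

module _ {o h : Level} {E B : Category o h} (p : Functor E B) where
  private
    module E = Category E
    module B = Category B
  open Functor p renaming (F₀ to p₀; F₁ to p₁)

  record CartesianLifting {X : B.Obj} (Q : E.Obj) (l : B.Hom X (p₀ Q)) : Set (o ⊔ h) where
    field
      L    : E.Obj
      over : p₀ L ≡ X
      arr  : E.Hom L Q
      arr-over : subst (λ A → B.Hom A (p₀ Q)) over (p₁ arr) ≡ l
      universal : ∀ {R} (g : E.Hom R Q) (k : B.Hom (p₀ R) X) → l B.∘ k ≡ p₁ g →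
        Σ (E.Hom R L) λ u → (subst (B.Hom (p₀ R)) over (p₁ u) ≡ k) × (arr E.∘ u ≡ g)
      unique : ∀ {R} (g : E.Hom R Q) (k : B.Hom (p₀ R) X) (u u' : E.Hom R L) →
        subst (B.Hom (p₀ R)) over (p₁ u) ≡ k → arr E.∘ u ≡ g →
        subst (B.Hom (p₀ R)) over (p₁ u') ≡ k → arr E.∘ u' ≡ g → u ≡ u'

  record Fibration : Set (o ⊔ h) where
    field
      cleavage : ∀ {X} (Q : E.Obj) (l : B.Hom X (p₀ Q)) → CartesianLifting Q l

  Fib : B.Obj → Set o
  Fib X = Σ E.Obj λ Q → p₀ Q ≡ X

  _⊑_ : ∀ {X} → Fib X → Fib X → Set h
  (Q , eQ) ⊑ (R , eR) = Σ (E.Hom Q R) λ f → subst₂ B.Hom eQ eR (p₁ f) ≡ B.id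

  reindex : Fibration → ∀ {X Y} → B.Hom X Y → Fib Y → Fib X
  reindex fib {X} l (Q , eQ) =
    CartesianLifting.L c , CartesianLifting.over c
    where c = Fibration.cleavage fib Q (subst (B.Hom X) (sym eQ) l)

  record IsCLatFibration (fib : Fibration) : Set (lsuc (o ⊔ h)) where
    field
      thin     : ∀ {X} {a b : Fib X} (f g : a ⊑ b) → proj₁ f ≡ proj₁ g
      antisym  : ∀ {X} {a b : Fib X} → a ⊑ b → b ⊑ a → a ≡ b
      complete : ∀ {X} (S : Fib X → Set (o ⊔ h)) → Σ (Fib X) (IsMeet _⊑_ S)
      reindex-meets : ∀ {X Y} (l : B.Hom X Y) →
        PreservesMeets (_⊑_ {Y}) (_⊑_ {X}) (o ⊔ h) (reindex fib l)

    _∧_ : ∀ {X} → Fib X → Fib X → Fib X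
    a ∧ b = proj₁ (complete (λ z → Lift h ((z ≡ a) ⊎ (z ≡ b))))

    _∨_ : ∀ {X} → Fib X → Fib X → Fib X
    a ∨ b = proj₁ (complete (λ z → Lift o ((a ⊑ z) × (b ⊑ z))))

  record Lifting (G : Functor B B) : Set (o ⊔ h) where
    open Functor G renaming (F₀ to G₀; F₁ to G₁)
    field
      Ġ : Functor E E
      over₀ : ∀ Q → p₀ (Functor.F₀ Ġ Q) ≡ G₀ (p₀ Q)
      over₁ : ∀ {Q R} (f : E.Hom Q R) →
        subst₂ B.Hom (over₀ Q) (over₀ R) (p₁ (Functor.F₁ Ġ f)) ≡ G₁ (p₁ f)

    restrict : ∀ {X} → Fib X → Fib (G₀ X)
    restrict (Q , eQ) = Functor.F₀ Ġ Q , trans (over₀ Q) (cong G₀ eQ)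

{-# OPTIONS --safe #-}
-- With K = H ∘ δ_* and F = δ^* ∘ Ġ_S, composing the two adjunctions gives K ⊣ F on the
-- complete lattice E_S, so K x ≤ x iff x ≤ F x. If ι ≤ ν then ν ≤ α ∧ F ν, hence K ν ≤ ν,
-- so ν is a prefixed point of ι ∨ K(-) and μ ≤ ν ≤ α. Dually, if μ ≤ α then μ is a
-- postfixed point of α ∧ F(-), so ι ≤ μ ≤ ν. Knaster–Tarski turns "least/greatest fixed
-- point" into "below every prefixed / above every postfixed point".
module Submission where

open import Level using (Level; _⊔_; Lift; lift; lower)
open import Data.Product using (_×_; Σ; _,_; proj₁; proj₂)
open import Data.Sum using (_⊎_; inj₁; inj₂)
open import Function using (_∘′_)
open import Relation.Binary.Core using (_Preserves_⟶_)
open import Relation.Binary.PropositionalEquality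
  using (_≡_; refl; subst₂; sym; trans; cong; cong₂)
open import Defs

module _ {a r b s c t : Level} {A : Set a} {B : Set b} {C : Set c}
         (_≤A_ : A → A → Set r) (_≤B_ : B → B → Set s) (_≤C_ : C → C → Set t) where

  adjoint-∘ : ∀ {g : B → A} {f : A → B} {g′ : C → B} {f′ : B → C} →
    IsLeftAdjointOf _≤A_ _≤B_ g f → IsLeftAdjointOf _≤B_ _≤C_ g′ f′ →
    IsLeftAdjointOf _≤A_ _≤C_ (g ∘′ g′) (f′ ∘′ f)
  adjoint-∘ g⊣f g′⊣f′ x y =
    (λ gg′x≤y → proj₁ (g′⊣f′ x _) (proj₁ (g⊣f _ y) gg′x≤y)) ,
    (λ x≤f′fy → proj₂ (g⊣f _ y) (proj₂ (g′⊣f′ x _) x≤f′fy))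

module CompleteLattice {a r : Level} {C : Set a} (_≤_ : C → C → Set r)
  (≤-refl : ∀ {x} → x ≤ x)
  (≤-trans : ∀ {x y z} → x ≤ y → y ≤ z → x ≤ z)
  (≤-antisym : ∀ {x y} → x ≤ y → y ≤ x → x ≡ y)
  (complete : ∀ (P : C → Set (a ⊔ r)) → Σ C (IsMeet _≤_ P)) where

  ≤-reflexive : ∀ {x y} → x ≡ y → x ≤ y
  ≤-reflexive refl = ≤-refl

  ⋀ : (C → Set (a ⊔ r)) → C
  ⋀ P = proj₁ (complete P)

  ⋀-lowerBound : ∀ P {x} → P x → ⋀ P ≤ x
  ⋀-lowerBound P = proj₁ (proj₂ (complete P)) _

  ⋀-greatest : ∀ P {z} → (∀ x → P x → z ≤ x) → z ≤ ⋀ P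
  ⋀-greatest P = proj₂ (proj₂ (complete P)) _

  infixr 35 _∧_
  infixr 30 _∨_

  _∧_ : C → C → C
  x ∧ y = ⋀ (λ z → Lift r ((z ≡ x) ⊎ (z ≡ y)))

  _∨_ : C → C → C
  x ∨ y = ⋀ (λ z → Lift a ((x ≤ z) × (y ≤ z)))

  x∧y≤x : ∀ x y → x ∧ y ≤ x
  x∧y≤x x y = ⋀-lowerBound _ (lift (inj₁ refl))

  x∧y≤y : ∀ x y → x ∧ y ≤ y
  x∧y≤y x y = ⋀-lowerBound _ (lift (inj₂ refl))

  ∧-greatest : ∀ {x y z} → z ≤ x → z ≤ y → z ≤ x ∧ y
  ∧-greatest z≤x z≤y = ⋀-greatest _ λ { _ (lift (inj₁ refl)) → z≤x ; _ (lift (inj₂ refl)) → z≤y }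

  x≤x∨y : ∀ x y → x ≤ x ∨ y
  x≤x∨y x y = ⋀-greatest _ (λ _ ub → proj₁ (lower ub))

  y≤x∨y : ∀ x y → y ≤ x ∨ y
  y≤x∨y x y = ⋀-greatest _ (λ _ ub → proj₂ (lower ub))

  ∨-least : ∀ {x y z} → x ≤ z → y ≤ z → x ∨ y ≤ z
  ∨-least x≤z y≤z = ⋀-lowerBound _ (lift (x≤z , y≤z))

  ∧-monoʳ : ∀ x {y z} → y ≤ z → x ∧ y ≤ x ∧ z
  ∧-monoʳ x y≤z = ∧-greatest (x∧y≤x _ _) (≤-trans (x∧y≤y _ _) y≤z)

  ∨-monoʳ : ∀ x {y z} → y ≤ z → x ∨ y ≤ x ∨ z
  ∨-monoʳ x y≤z = ∨-least (x≤x∨y _ _) (≤-trans y≤z (y≤x∨y _ _))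

  module _ {f : C → C} (f-mono : f Preserves _≤_ ⟶ _≤_) where

    -- Knaster–Tarski: the greatest postfixed point is the meet of all upper bounds of postfixed points.
    postfixed≤gfp : ∀ {n y} → IsGFP _≤_ f n → y ≤ f y → y ≤ n
    postfixed≤gfp {n} {y} (_ , n-greatest) y≤fy = ≤-trans (ν-upperBound y≤fy) (n-greatest ν fν≡ν)
      where
      ν : C
      ν = ⋀ (λ z → ∀ x → x ≤ f x → x ≤ z)
      ν-upperBound : ∀ {x} → x ≤ f x → x ≤ ν
      ν-upperBound x≤fx = ⋀-greatest _ (λ _ ub → ub _ x≤fx)
      ν≤fν : ν ≤ f ν
      ν≤fν = ⋀-lowerBound _ (λ x x≤fx → ≤-trans x≤fx (f-mono (ν-upperBound x≤fx)))
      fν≡ν : f ν ≡ ν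
      fν≡ν = ≤-antisym (ν-upperBound (f-mono ν≤fν)) ν≤fν

    lfp≤prefixed : ∀ {m y} → IsLFP _≤_ f m → f y ≤ y → m ≤ y
    lfp≤prefixed {m} {y} (_ , m-least) fy≤y = ≤-trans (m-least μ fμ≡μ) (μ-lowerBound fy≤y)
      where
      μ : C
      μ = ⋀ (λ z → Lift a (f z ≤ z))
      μ-lowerBound : ∀ {x} → f x ≤ x → μ ≤ x
      μ-lowerBound fx≤x = ⋀-lowerBound _ (lift fx≤x)
      fμ≤μ : f μ ≤ μ
      fμ≤μ = ⋀-greatest _ (λ x fx≤x → ≤-trans (f-mono (μ-lowerBound (lower fx≤x))) (lower fx≤x))
      fμ≡μ : f μ ≡ μ
      fμ≡μ = ≤-antisym fμ≤μ (μ-lowerBound (f-mono fμ≤μ))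

  module _ {K F : C → C} (K⊣F : IsLeftAdjointOf _≤_ _≤_ K F) where

    K≤⇒≤F : ∀ {x y} → K x ≤ y → x ≤ F y
    K≤⇒≤F = proj₁ (K⊣F _ _)

    ≤F⇒K≤ : ∀ {x y} → x ≤ F y → K x ≤ y
    ≤F⇒K≤ = proj₂ (K⊣F _ _)

    F-mono : F Preserves _≤_ ⟶ _≤_
    F-mono x≤y = K≤⇒≤F (≤-trans (≤F⇒K≤ ≤-refl) x≤y)

    K-mono : K Preserves _≤_ ⟶ _≤_
    K-mono x≤y = ≤F⇒K≤ (≤-trans x≤y (K≤⇒≤F ≤-refl))

    ≤gfp⇔lfp≤ : ∀ {ι α n m} →
      IsGFP _≤_ (λ x → α ∧ F x) n → IsLFP _≤_ (λ x → ι ∨ K x) m →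
      (ι ≤ n → m ≤ α) × (m ≤ α → ι ≤ n)
    ≤gfp⇔lfp≤ {ι} {α} {n} {m} n-gfp@(fn≡n , _) m-lfp@(gm≡m , _) = ≤gfp⇒lfp≤ , lfp≤⇒≤gfp
      where
      n≤α∧Fn : n ≤ α ∧ F n
      n≤α∧Fn = ≤-reflexive (sym fn≡n)
      ι∨Km≤m : ι ∨ K m ≤ m
      ι∨Km≤m = ≤-reflexive gm≡m

      ≤gfp⇒lfp≤ : ι ≤ n → m ≤ α
      ≤gfp⇒lfp≤ ι≤n = ≤-trans m≤n (≤-trans n≤α∧Fn (x∧y≤x _ _))
        where
        m≤n : m ≤ n
        m≤n = lfp≤prefixed (∨-monoʳ ι ∘′ K-mono) m-lfp
                (∨-least ι≤n (≤F⇒K≤ (≤-trans n≤α∧Fn (x∧y≤y _ _))))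

      lfp≤⇒≤gfp : m ≤ α → ι ≤ n
      lfp≤⇒≤gfp m≤α = ≤-trans (≤-trans (x≤x∨y _ _) ι∨Km≤m) m≤n
        where
        m≤n : m ≤ n
        m≤n = postfixed≤gfp (∧-monoʳ α ∘′ F-mono) n-gfp
                (∧-greatest m≤α (K≤⇒≤F (≤-trans (y≤x∨y _ _) ι∨Km≤m)))

module Fibre {o h : Level} {E B : Category o h} (p : Functor E B) where
  private
    module E = Category E
    module B = Category B
  open Functor p renaming (F₁ to p₁)

  subst₂-id : ∀ {X Y} (e : X ≡ Y) → subst₂ B.Hom e e (B.id {X}) ≡ B.id
  subst₂-id refl = refl

  subst₂-∘ : ∀ {X X′ X″ Y} (e : X ≡ Y) (e′ : X′ ≡ Y) (e″ : X″ ≡ Y)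
    (u : B.Hom X′ X″) (v : B.Hom X X′) →
    subst₂ B.Hom e e″ (u B.∘ v) ≡ subst₂ B.Hom e′ e″ u B.∘ subst₂ B.Hom e e′ v
  subst₂-∘ refl refl refl u v = refl

  ⊑-refl : ∀ {X} {x : Fib p X} → _⊑_ p x x
  ⊑-refl {x = Q , eQ} = E.id , trans (cong (subst₂ B.Hom eQ eQ) identity) (subst₂-id eQ)

  ⊑-trans : ∀ {X} {x y z : Fib p X} → _⊑_ p x y → _⊑_ p y z → _⊑_ p x z
  ⊑-trans {x = Q , eQ} {R , eR} {T , eT} (u , u-vertical) (v , v-vertical) =
    v E.∘ u ,
    trans (cong (subst₂ B.Hom eQ eT) (homomorphism v u))
      (trans (subst₂-∘ eQ eR eT (p₁ v) (p₁ u))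
        (trans (cong₂ B._∘_ v-vertical u-vertical) (B.identityˡ B.id)))

proposition5 : ∀ {o h : Level} {E B : Category o h} (p : Functor E B)
    (fib : Fibration p) (clat : IsCLatFibration p fib)
    (G : Functor B B) {S : Category.Obj B}
    (δ : Category.Hom B S (Functor.F₀ G S))
    (L : Lifting p G)
    (ωcont : ∀ X → OmegaOpContinuous (_⊑_ p {X}) (_⊑_ p {Functor.F₀ G X}) (Lifting.restrict L {X}))
    (meets : ∀ X → PreservesMeets (_⊑_ p {X}) (_⊑_ p {Functor.F₀ G X}) (o ⊔ h) (Lifting.restrict L {X}))
    (H : Fib p (Functor.F₀ G S) → Fib p S)
    (H-adj : IsLeftAdjointOf (_⊑_ p {S}) (_⊑_ p {Functor.F₀ G S}) H (Lifting.restrict L {S}))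
    (δ! : Fib p S → Fib p (Functor.F₀ G S))
    (δ!-adj : IsLeftAdjointOf (_⊑_ p {Functor.F₀ G S}) (_⊑_ p {S}) δ! (reindex p fib δ))
    (ι α n m : Fib p S) →
    IsGFP (_⊑_ p {S}) (λ x → IsCLatFibration._∧_ clat α (reindex p fib δ (Lifting.restrict L x))) n →
    IsLFP (_⊑_ p {S}) (λ x → IsCLatFibration._∨_ clat ι (H (δ! x))) m →
    ((_⊑_ p ι n → _⊑_ p m α) × (_⊑_ p m α → _⊑_ p ι n))
proposition5 p fib clat G δ L _ _ H H-adj δ! δ!-adj ι α n m =
  CompleteLattice.≤gfp⇔lfp≤ (_⊑_ p) ⊑-refl ⊑-trans
    (IsCLatFibration.antisym clat) (IsCLatFibration.complete clat)
    (adjoint-∘ (_⊑_ p) (_⊑_ p) (_⊑_ p) H-adj δ!-adj)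
  where open Fibre p
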